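{- Let $G$ be a finite group, $A,B$ be $G$-modules, and $p\ge 0$, $q\ge 1$ integers. Let $f'\in F^{ -p-q}(G,A)$, $f''\in F^{p}(G,B)$ be homogeneous cochains with corresponding inhomogeneous cochains $c'\in C^{ -p-q}(G,A)$, $c''\in C^{p}(G,B)$, and let $f=f'\cup f''\in F^{ -q}(G,A\otimes B)$ be given by \[f(g_1,\dots,g_q)=\sum_{s_1,\dots,s_p\in G} f'(g_1,\dots,g_q,s_1,\dots,s_p)\otimes f''(s_p,\dots,s_1,g_q).\] Then the inhomogeneous cochain $c\in C^{ -q}(G,A\otimes B)$ corresponding to $f$ is \[c(h_1,\dots,h_{q-1})=\sum_{t_1,\dots,t_p\in G} c'(h_1,\dots,h_{q-1},t_1,\dots,t_p)\otimes (h_1\cdots h_{q-1}t_1\cdots t_p)\cdot c''(t_p^{ -1},\dots,t_1^{ -1}).\]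
   Context: For a $G$-module $A$: the homogeneous cochains are $F^n(G,A)$ = the $G$-equivariant maps $G^{n+1}\to A$ for $n\ge0$ and $G^{ -n}\to A$ for $n<0$ ($G$ acting diagonally on $G^k$ by left multiplication); the inhomogeneous cochains are $C^n(G,A)$ = all maps $G^n\to A$ for $n\ge 0$ and $G^{ -n-1}\to A$ for $n<0$. A homogeneous $f\in F^n$ and inhomogeneous $c\in C^n$ correspond when, for $n\ge 0$, $c(h_1,\dots,h_n)=f(1,h_1,h_1h_2,\dots,h_1\cdots h_n)$, equivalently $f(g_0,\dots,g_n)=g_0\,c(g_0^{ -1}g_1,\dots,g_{n-1}^{ -1}g_n)$; and for $n<0$, $c(h_1,\dots,h_{ -n-1})=f(1,h_1,h_1h_2,\dots,h_1\cdots h_{ -n-1})$, equivalently $f(g_1,\dots,g_{ -n})=g_1\,c(g_1^{ -1}g_2,\dots,g_{ -n-1}^{ -1}g_{ -n})$. $A\otimes B$ carries the diagonal $G$-action. The sums run over $s_i$ (resp. $t_i$) ranging independently over $G$. -}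

module Defs where

open import Level using (0ℓ)
open import Data.Nat using (ℕ; zero; suc; pred)
open import Data.Fin using (Fin)
open import Data.Vec using (Vec; []; _∷_; map; foldr)
open import Data.Vec.Relation.Binary.Pointwise.Inductive using (Pointwise)
open import Data.Product using (Σ; _×_; _,_)
open import Relation.Binary.PropositionalEquality using (_≡_)
open import Algebra.Bundles using (Group; AbelianGroup)

record FiniteGroup : Set₁ where
  field
    grp        : Group 0ℓ 0ℓ
  open Group grp public
  field
    card       : ℕ
    enum       : Fin card → Carrier
    index      : Carrier → Fin card
    enum-index : ∀ g → enum (index g) ≈ g
    index-enum : ∀ i → index (enum i) ≡ i
    index-cong : ∀ {g h} → g ≈ h → index g ≡ index h

-- G-modules: abelian groups (written additively in the paper; the stdlib
-- AbelianGroup bundle uses _∙_, ε, _⁻¹) with a left G-action by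
-- group endomorphisms.

record GModule (G : FiniteGroup) : Set₁ where
  private module G = FiniteGroup G
  field
    mod : AbelianGroup 0ℓ 0ℓ
  open AbelianGroup mod public
  field
    _·_      : G.Carrier → Carrier → Carrier
    ·-cong   : ∀ {g h a b} → g G.≈ h → a ≈ b → (g · a) ≈ (h · b)
    ·-additive : ∀ g a b → (g · (a ∙ b)) ≈ ((g · a) ∙ (g · b))
    ·-identity : ∀ a → (G.ε · a) ≈ a
    ·-assoc  : ∀ g h a → ((g G.∙ h) · a) ≈ (g · (h · a))

record IsBiadditive (A B : AbelianGroup 0ℓ 0ℓ) (M : AbelianGroup 0ℓ 0ℓ)
         (φ : AbelianGroup.Carrier A → AbelianGroup.Carrier B → AbelianGroup.Carrier M) : Set where
  private
    module A = AbelianGroup A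
    module B = AbelianGroup B
    module M = AbelianGroup M
  field
    cong  : ∀ {a a' b b'} → a A.≈ a' → b B.≈ b' → φ a b M.≈ φ a' b'
    addˡ  : ∀ a a' b → φ (a A.∙ a') b M.≈ (φ a b M.∙ φ a' b)
    addʳ  : ∀ a b b' → φ a (b B.∙ b') M.≈ (φ a b M.∙ φ a b')

record IsAddHom (T M : AbelianGroup 0ℓ 0ℓ)
         (h : AbelianGroup.Carrier T → AbelianGroup.Carrier M) : Set where
  private
    module T = AbelianGroup T
    module M = AbelianGroup M
  field
    cong : ∀ {x y} → x T.≈ y → h x M.≈ h y
    hom  : ∀ x y → h (x T.∙ y) M.≈ (h x M.∙ h y)

record TensorProduct {G : FiniteGroup} (A B : GModule G) : Set₁ where
  private
    module G = FiniteGroup G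
    module A = GModule A
    module B = GModule B
  field
    T   : GModule G
  private module T = GModule T
  field
    _⊗_         : A.Carrier → B.Carrier → T.Carrier
    ⊗-biadditive : IsBiadditive A.mod B.mod T.mod _⊗_
    ⊗-diagonal  : ∀ g a b → (g T.· (a ⊗ b)) T.≈ ((g A.· a) ⊗ (g B.· b))
    universal   : ∀ (M : AbelianGroup 0ℓ 0ℓ) φ → IsBiadditive A.mod B.mod M φ →
                  Σ (T.Carrier → AbelianGroup.Carrier M) λ h →
                    IsAddHom T.mod M h × (∀ a b → AbelianGroup._≈_ M (h (a ⊗ b)) (φ a b))
    unique      : ∀ (M : AbelianGroup 0ℓ 0ℓ) h h' → IsAddHom T.mod M h → IsAddHom T.mod M h' →
                  (∀ a b → AbelianGroup._≈_ M (h (a ⊗ b)) (h' (a ⊗ b))) →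
                  ∀ x → AbelianGroup._≈_ M (h x) (h' x)

module _ {G : FiniteGroup} where
  private module G = FiniteGroup G

  record Equivariant (A : GModule G) (k : ℕ) : Set where
    private module A = GModule A
    field
      fun   : Vec G.Carrier k → A.Carrier
      cong  : ∀ {v w} → Pointwise G._≈_ v w → fun v A.≈ fun w
      equiv : ∀ g v → fun (map (g G.∙_) v) A.≈ (g A.· fun v)

  -- Homogeneous cochains: F^n(G,A) for n ≥ 0 is Fpos A n (maps on G^{n+1});
  -- F^{-k}(G,A) for k ≥ 1 is Fneg A k (maps on G^k).
  Fpos : GModule G → ℕ → Set
  Fpos A n = Equivariant A (suc n)

  Fneg : GModule G → ℕ → Set
  Fneg A k = Equivariant A k

  -- Inhomogeneous cochains: C^n(G,A) for n ≥ 0 is Cpos A n (all maps G^n → A);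
  -- C^{-k}(G,A) for k ≥ 1 is Cneg A k (all maps G^{k-1} → A).
  Cpos : GModule G → ℕ → Set
  Cpos A n = Vec G.Carrier n → GModule.Carrier A

  Cneg : GModule G → ℕ → Set
  Cneg A k = Vec G.Carrier (pred k) → GModule.Carrier A

  partials : ∀ {m} → G.Carrier → Vec G.Carrier m → Vec G.Carrier m
  partials acc []       = []
  partials acc (h ∷ hs) = (acc G.∙ h) ∷ partials (acc G.∙ h) hs

  homArgs : ∀ {m} → Vec G.Carrier m → Vec G.Carrier (suc m)
  homArgs h = G.ε ∷ partials G.ε h

  prod : ∀ {m} → Vec G.Carrier m → G.Carrier
  prod = foldr _ G._∙_ G.ε

  -- This is the same formula for n = m ≥ 0 and for n = -(m+1) < 0.
  Corresponds : (A : GModule G) (m : ℕ) →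
                (Vec G.Carrier (suc m) → GModule.Carrier A) →
                (Vec G.Carrier m → GModule.Carrier A) → Set
  Corresponds A m f c = ∀ h → GModule._≈_ A (c h) (f (homArgs h))

sumFin : (M : AbelianGroup 0ℓ 0ℓ) (n : ℕ) → (Fin n → AbelianGroup.Carrier M) → AbelianGroup.Carrier M
sumFin M zero    f = AbelianGroup.ε M
sumFin M (suc n) f = AbelianGroup._∙_ M (f Fin.zero) (sumFin M n (λ i → f (Fin.suc i)))

module _ (G : FiniteGroup) (M : AbelianGroup 0ℓ 0ℓ) where
  private module G = FiniteGroup G

  sumG : (G.Carrier → AbelianGroup.Carrier M) → AbelianGroup.Carrier M
  sumG f = sumFin M G.card (λ i → f (G.enum i))

  sumGs : (p : ℕ) → (Vec G.Carrier p → AbelianGroup.Carrier M) → AbelianGroup.Carrier M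
  sumGs zero    f = f []
  sumGs (suc p) f = sumG (λ s → sumGs p (λ v → f (s ∷ v)))

-- With P = h₁⋯h_{q-1}, the substitution s = (Pt₁, Pt₁t₂, …, Pt₁⋯t_p) is a bijection of G^p
-- (an iterated left translation), so the defining sum of f may be taken over t instead.
-- It turns (1, h₁, …, h₁⋯h_{q-1}, s) into the homogeneous arguments of (h, t), giving the c'
-- factor, and turns (s_p, …, s₁, P) into the translate by Pt₁⋯t_p of
-- (1, t_p⁻¹, t_p⁻¹t_{p-1}⁻¹, …, t_p⁻¹⋯t₁⁻¹), so equivariance of f'' gives the c'' factor.
module Submission where

open import Defs
open import Data.Nat using (ℕ; suc; _+_)
open import Data.Vec using (Vec; _++_; reverse; _∷ʳ_; last; map)
open import Level using (0ℓ)
open import Data.Fin using (Fin)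
open import Data.Fin.Permutation using (Permutation′; permutation; _⟨$⟩ʳ_)
open import Data.Vec using ([]; _∷_; foldl′)
open import Data.Vec.Properties using (reverse-∷; map-∷ʳ; foldl-∷ʳ)
open import Data.Vec.Relation.Binary.Pointwise.Inductive using ([]; _∷_)
import Data.Vec.Relation.Binary.Equality.Setoid as VecEquality
open import Relation.Binary.PropositionalEquality as ≡ using (_≡_)
open import Algebra.Bundles using (AbelianGroup)
import Algebra.Properties.Group as GroupProperties
import Algebra.Properties.CommutativeMonoid.Sum as Sum
import Relation.Binary.Reasoning.Setoid as SetoidReasoning

module _ (M : AbelianGroup 0ℓ 0ℓ) where
  open AbelianGroup M
  open Sum commutativeMonoid using (sum; sum-cong-≋; sum-permute)

  sumFin≡sum : ∀ n (f : Fin n → Carrier) → sumFin M n f ≡ sum f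
  sumFin≡sum ℕ.zero  f = ≡.refl
  sumFin≡sum (suc n) f = ≡.cong (f Fin.zero ∙_) (sumFin≡sum n (λ i → f (Fin.suc i)))

  sumFin-cong : ∀ n {f g : Fin n → Carrier} → (∀ i → f i ≈ g i) → sumFin M n f ≈ sumFin M n g
  sumFin-cong n {f} {g} f≈g rewrite sumFin≡sum n f | sumFin≡sum n g = sum-cong-≋ f≈g

  sumFin-permute : ∀ n (π : Permutation′ n) (f : Fin n → Carrier) →
                   sumFin M n (λ i → f (π ⟨$⟩ʳ i)) ≈ sumFin M n f
  sumFin-permute n π f
    rewrite sumFin≡sum n f | sumFin≡sum n (λ i → f (π ⟨$⟩ʳ i)) = sym (sum-permute f π)

module FiniteGroupProperties (G : FiniteGroup) where
  open FiniteGroup G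
  open GroupProperties grp using (⁻¹-anti-homo-∙; //-rightDividesʳ; ε⁻¹≈ε)
  open VecEquality setoid using (_≋_; ≋-setoid)

  translate-inverse : ∀ {x y} → x ∙ y ≈ ε → ∀ j → index (x ∙ enum (index (y ∙ enum j))) ≡ j
  translate-inverse {x} {y} xy≈ε j = ≡.trans (index-cong (begin
    x ∙ enum (index (y ∙ enum j)) ≈⟨ ∙-congˡ (enum-index _) ⟩
    x ∙ (y ∙ enum j)              ≈⟨ assoc x y _ ⟨
    (x ∙ y) ∙ enum j              ≈⟨ ∙-congʳ xy≈ε ⟩
    ε ∙ enum j                    ≈⟨ identityˡ _ ⟩
    enum j                        ∎)) (index-enum j)
    where open SetoidReasoning setoid

  translation : Carrier → Permutation′ card
  translation x = permutation (λ i → index (x ∙ enum i)) (λ i → index (x ⁻¹ ∙ enum i))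
                              (translate-inverse (inverseʳ x)) (translate-inverse (inverseˡ x))

  ∷ʳ⁺ : ∀ {m} {xs ys : Vec Carrier m} {x y} → xs ≋ ys → x ≈ y → xs ∷ʳ x ≋ ys ∷ʳ y
  ∷ʳ⁺ []           x≈y = x≈y ∷ []
  ∷ʳ⁺ (z≈w ∷ xs≋ys) x≈y = z≈w ∷ ∷ʳ⁺ xs≋ys x≈y

  reverse⁺ : ∀ {m} {xs ys : Vec Carrier m} → xs ≋ ys → reverse xs ≋ reverse ys
  reverse⁺ [] = []
  reverse⁺ {xs = x ∷ xs} {y ∷ ys} (x≈y ∷ xs≋ys)
    rewrite reverse-∷ x xs | reverse-∷ y ys = ∷ʳ⁺ (reverse⁺ xs≋ys) x≈y

  foldl-∙≈∙prod : ∀ {m} a (h : Vec Carrier m) → foldl′ _∙_ a h ≈ a ∙ prod {G = G} h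
  foldl-∙≈∙prod a []       = sym (identityʳ a)
  foldl-∙≈∙prod a (x ∷ xs) = trans (foldl-∙≈∙prod (a ∙ x) xs) (assoc a x _)

  partials-++ : ∀ {m n} acc (h : Vec Carrier m) (t : Vec Carrier n) →
                partials {G = G} acc (h ++ t) ≡
                partials {G = G} acc h ++ partials {G = G} (foldl′ _∙_ acc h) t
  partials-++ acc []      t = ≡.refl
  partials-++ acc (x ∷ h) t = ≡.cong ((acc ∙ x) ∷_) (partials-++ (acc ∙ x) h t)

  partials-∷ʳ : ∀ {m} acc (v : Vec Carrier m) y →
                partials {G = G} acc (v ∷ʳ y) ≡ partials {G = G} acc v ∷ʳ foldl′ _∙_ acc (v ∷ʳ y)
  partials-∷ʳ acc []      y = ≡.refl
  partials-∷ʳ acc (x ∷ v) y = ≡.cong ((acc ∙ x) ∷_) (partials-∷ʳ (acc ∙ x) v y)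

  last-∷-partials : ∀ {m} acc (h : Vec Carrier m) →
                    last (acc ∷ partials {G = G} acc h) ≡ foldl′ _∙_ acc h
  last-∷-partials acc []      = ≡.refl
  last-∷-partials acc (x ∷ h) = last-∷-partials (acc ∙ x) h

  homArgs-++ : ∀ {m n} (h : Vec Carrier m) (t : Vec Carrier n) →
               homArgs {G = G} (h ++ t) ≡ homArgs {G = G} h ++ partials {G = G} (foldl′ _∙_ ε h) t
  homArgs-++ h t = ≡.cong (ε ∷_) (partials-++ ε h t)

  homArgs-∷ʳ : ∀ {m} (v : Vec Carrier m) y →
               homArgs {G = G} (v ∷ʳ y) ≡ homArgs {G = G} v ∷ʳ foldl′ _∙_ ε (v ∷ʳ y)
  homArgs-∷ʳ v y = ≡.cong (ε ∷_) (partials-∷ʳ ε v y)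

  foldl-reverse-inverses : ∀ {m} a (t : Vec Carrier m) →
                           foldl′ _∙_ a (reverse (map _⁻¹ t)) ≈ a ∙ prod {G = G} t ⁻¹
  foldl-reverse-inverses a [] = begin
    a      ≈⟨ identityʳ a ⟨
    a ∙ ε  ≈⟨ ∙-congˡ ε⁻¹≈ε ⟨
    a ∙ ε ⁻¹ ∎
    where open SetoidReasoning setoid
  foldl-reverse-inverses a (x ∷ t) = begin
    foldl′ _∙_ a (reverse (x ⁻¹ ∷ map _⁻¹ t))  ≡⟨ ≡.cong (foldl′ _∙_ a) (reverse-∷ (x ⁻¹) (map _⁻¹ t)) ⟩
    foldl′ _∙_ a (reverse (map _⁻¹ t) ∷ʳ x ⁻¹) ≡⟨ foldl-∷ʳ _ _∙_ a (x ⁻¹) (reverse (map _⁻¹ t)) ⟩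
    foldl′ _∙_ a (reverse (map _⁻¹ t)) ∙ x ⁻¹  ≈⟨ ∙-congʳ (foldl-reverse-inverses a t) ⟩
    (a ∙ P ⁻¹) ∙ x ⁻¹                          ≈⟨ assoc a _ _ ⟩
    a ∙ (P ⁻¹ ∙ x ⁻¹)                          ≈⟨ ∙-congˡ (⁻¹-anti-homo-∙ x P) ⟨
    a ∙ (x ∙ P) ⁻¹                             ∎
    where
    open SetoidReasoning setoid
    P = prod {G = G} t

  foldl-∙-cancel : ∀ {m} x (t : Vec Carrier m) →
                   foldl′ _∙_ x t ∙ foldl′ _∙_ ε (reverse (map _⁻¹ t)) ≈ x
  foldl-∙-cancel x t = begin
    foldl′ _∙_ x t ∙ foldl′ _∙_ ε (reverse (map _⁻¹ t))
      ≈⟨ ∙-cong (foldl-∙≈∙prod x t) (foldl-reverse-inverses ε t) ⟩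
    (x ∙ P) ∙ (ε ∙ P ⁻¹)  ≈⟨ ∙-congˡ (identityˡ _) ⟩
    (x ∙ P) ∙ P ⁻¹        ≈⟨ //-rightDividesʳ P x ⟩
    x                     ∎
    where
    open SetoidReasoning setoid
    P = prod {G = G} t

  reverse-partials≋translate-homArgs :
    ∀ {m} x (t : Vec Carrier m) →
    reverse (x ∷ partials {G = G} x t) ≋
    map (foldl′ _∙_ x t ∙_) (homArgs {G = G} (reverse (map _⁻¹ t)))
  reverse-partials≋translate-homArgs x [] = sym (identityʳ x) ∷ []
  reverse-partials≋translate-homArgs {suc m} x (a ∷ t) = begin
    reverse (x ∷ (x ∙ a) ∷ partials {G = G} (x ∙ a) t)
      ≡⟨ reverse-∷ x ((x ∙ a) ∷ partials {G = G} (x ∙ a) t) ⟩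
    reverse ((x ∙ a) ∷ partials {G = G} (x ∙ a) t) ∷ʳ x
      ≈⟨ ∷ʳ⁺ (reverse-partials≋translate-homArgs (x ∙ a) t) (sym (foldl-∙-cancel x (a ∷ t))) ⟩
    map (z ∙_) (homArgs {G = G} v) ∷ʳ (z ∙ foldl′ _∙_ ε w)
      ≡⟨ map-∷ʳ (z ∙_) _ (homArgs {G = G} v) ⟨
    map (z ∙_) (homArgs {G = G} v ∷ʳ foldl′ _∙_ ε w)
      ≡⟨ ≡.cong (λ u → map (z ∙_) (homArgs {G = G} v ∷ʳ foldl′ _∙_ ε u)) w≡v∷ʳa⁻¹ ⟩
    map (z ∙_) (homArgs {G = G} v ∷ʳ foldl′ _∙_ ε (v ∷ʳ a ⁻¹))
      ≡⟨ ≡.cong (map (z ∙_)) (homArgs-∷ʳ v (a ⁻¹)) ⟨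
    map (z ∙_) (homArgs {G = G} (v ∷ʳ a ⁻¹))
      ≡⟨ ≡.cong (λ u → map (z ∙_) (homArgs {G = G} u)) w≡v∷ʳa⁻¹ ⟨
    map (z ∙_) (homArgs {G = G} w) ∎
    where
    open SetoidReasoning (≋-setoid (suc (suc m)))
    z : Carrier
    z = foldl′ _∙_ (x ∙ a) t
    v : Vec Carrier m
    v = reverse (map _⁻¹ t)
    w : Vec Carrier (suc m)
    w = reverse (map _⁻¹ (a ∷ t))
    w≡v∷ʳa⁻¹ : w ≡ v ∷ʳ a ⁻¹
    w≡v∷ʳa⁻¹ = reverse-∷ (a ⁻¹) (map _⁻¹ t)

module Summation (G : FiniteGroup) (M : AbelianGroup 0ℓ 0ℓ) where
  private module G = FiniteGroup G
  open AbelianGroup M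
  open FiniteGroupProperties G using (translation)
  open VecEquality G.setoid using (_≋_; ≋-refl)

  sumG-translate : (φ : G.Carrier → Carrier) → (∀ {a b} → a G.≈ b → φ a ≈ φ b) →
                   ∀ x → sumG G M (λ s → φ (x G.∙ s)) ≈ sumG G M φ
  sumG-translate φ φ-cong x =
    trans (sumFin-cong M G.card (λ i → φ-cong (G.sym (G.enum-index _))))
          (sumFin-permute M G.card (translation x) (λ i → φ (G.enum i)))

  sumGs-cong : ∀ p {F F′ : Vec G.Carrier p → Carrier} → (∀ v → F v ≈ F′ v) →
               sumGs G M p F ≈ sumGs G M p F′
  sumGs-cong ℕ.zero  F≈F′ = F≈F′ []
  sumGs-cong (suc p) F≈F′ = sumFin-cong M G.card (λ i → sumGs-cong p (λ v → F≈F′ (G.enum i ∷ v)))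

  sumGs-partials : ∀ p (F : Vec G.Carrier p → Carrier) → (∀ {v w} → v ≋ w → F v ≈ F w) →
                   ∀ x → sumGs G M p (λ t → F (partials {G = G} x t)) ≈ sumGs G M p F
  sumGs-partials ℕ.zero  F F-cong x = refl
  sumGs-partials (suc p) F F-cong x = trans
    (sumFin-cong M G.card (λ i →
      sumGs-partials p (λ s → F ((x G.∙ G.enum i) ∷ s)) (λ v≋w → F-cong (G.refl ∷ v≋w)) (x G.∙ G.enum i)))
    (sumG-translate (λ a → sumGs G M p (λ s → F (a ∷ s)))
                    (λ a≈b → sumGs-cong p (λ v → F-cong (a≈b ∷ ≋-refl))) x)

module _ {G : FiniteGroup} (B : GModule G) where
  private module G = FiniteGroup G
  open GModule B
  open FiniteGroupProperties G using (reverse-partials≋translate-homArgs; foldl-∙≈∙prod)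

  reverse-partials-correspondence :
    ∀ {p} (f : Fpos B p) {c : Cpos B p} → Corresponds B p (Equivariant.fun f) c →
    ∀ x (t : Vec G.Carrier p) → Equivariant.fun f (reverse (x ∷ partials {G = G} x t)) ≈
            ((x G.∙ prod {G = G} t) · c (reverse (map G._⁻¹ t)))
  reverse-partials-correspondence {p} f {c} c∼f x t = begin
    f.fun (reverse (x ∷ partials {G = G} x t))  ≈⟨ f.cong (reverse-partials≋translate-homArgs x t) ⟩
    f.fun (map (z G.∙_) (homArgs {G = G} u))    ≈⟨ f.equiv z _ ⟩
    z · f.fun (homArgs {G = G} u)               ≈⟨ ·-cong (foldl-∙≈∙prod x t) (sym (c∼f u)) ⟩
    (x G.∙ prod {G = G} t) · c u                ∎
    where
    open SetoidReasoning setoid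
    module f = Equivariant f
    z : G.Carrier
    z = foldl′ G._∙_ x t
    u : Vec G.Carrier p
    u = reverse (map G._⁻¹ t)

mainTheorem5 :
  (G : FiniteGroup) (A B : GModule G) (AB : TensorProduct A B) (p r : ℕ) →
  -- the paper's q ≥ 1 is suc r
  (f' : Fneg A (suc r + p)) (f'' : Fpos B p)
  (c' : Cneg A (suc r + p)) (c'' : Cpos B p) →
  Corresponds A (r + p) (Equivariant.fun f') c' →
  Corresponds B p (Equivariant.fun f'') c'' →
  let open TensorProduct AB
      module G = FiniteGroup G
      module T = GModule T
      module B = GModule B
      f : Vec G.Carrier (suc r) → T.Carrier
      f g = sumGs G T.mod p (λ s →
              Equivariant.fun f' (g ++ s) ⊗ Equivariant.fun f'' (reverse s ∷ʳ last g))
      c : Vec G.Carrier r → T.Carrier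
      c h = sumGs G T.mod p (λ t →
              c' (h ++ t) ⊗ ((prod {G = G} h G.∙ prod {G = G} t) B.· c'' (reverse (map G._⁻¹ t))))
  in Corresponds T r f c
mainTheorem5 G A B AB p r f' f'' c' c'' c'∼f' c''∼f'' h =
  T.trans (sumGs-cong p (λ t → ⊗-cong (c'-factor t) (c''-factor t)))
          (sumGs-partials p F F-cong P)
  where
  open TensorProduct AB
  module G = FiniteGroup G
  module A = GModule A
  module B = GModule B
  module T = GModule T
  module f' = Equivariant f'
  module f'' = Equivariant f''
  open FiniteGroupProperties G
  open Summation G T.mod
  open VecEquality G.setoid using (_≋_; ≋-refl; ++⁺)
  open IsBiadditive ⊗-biadditive using () renaming (cong to ⊗-cong)

  g : Vec G.Carrier (suc r)
  g = homArgs {G = G} h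

  P : G.Carrier
  P = foldl′ G._∙_ G.ε h

  F : Vec G.Carrier p → T.Carrier
  F s = f'.fun (g ++ s) ⊗ f''.fun (reverse s ∷ʳ last g)

  F-cong : ∀ {v w} → v ≋ w → F v T.≈ F w
  F-cong v≋w = ⊗-cong (f'.cong (++⁺ ≋-refl v≋w)) (f''.cong (∷ʳ⁺ (reverse⁺ v≋w) G.refl))

  c'-factor : ∀ t → c' (h ++ t) A.≈ f'.fun (g ++ partials {G = G} P t)
  c'-factor t = A.trans (c'∼f' (h ++ t)) (A.reflexive (≡.cong f'.fun (homArgs-++ h t)))

  c''-factor : ∀ t → ((prod {G = G} h G.∙ prod {G = G} t) B.· c'' (reverse (map G._⁻¹ t))) B.≈
                     f''.fun (reverse (partials {G = G} P t) ∷ʳ last g)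
  c''-factor t = begin
    (prod {G = G} h G.∙ prod {G = G} t) B.· c'' u  ≈⟨ B.·-cong (G.∙-congʳ prod≈P) B.refl ⟩
    (P G.∙ prod {G = G} t) B.· c'' u               ≈⟨ reverse-partials-correspondence B f'' c''∼f'' P t ⟨
    f''.fun (reverse (P ∷ s))                      ≡⟨ ≡.cong f''.fun (reverse-∷ P s) ⟩
    f''.fun (reverse s ∷ʳ P)                       ≡⟨ ≡.cong (λ y → f''.fun (reverse s ∷ʳ y)) (last-∷-partials G.ε h) ⟨
    f''.fun (reverse s ∷ʳ last g)                  ∎
    where
    open SetoidReasoning B.setoid
    u s : Vec G.Carrier p
    u = reverse (map G._⁻¹ t)
    s = partials {G = G} P t
    prod≈P : prod {G = G} h G.≈ P
    prod≈P = G.sym (G.trans (foldl-∙≈∙prod G.ε h) (G.identityˡ _))
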